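{- Let $G=(V,E)$ be a finite simple undirected graph with vertices $v_1,\dots,v_n$. For $1\le i,j\le n$ let $e_{ij}=i\cdot n^2+j\cdot n$, and write each edge as $(v_i,v_j)$ in a fixed orientation. Let $c_0,\dots,c_n,b$ be distinct variables. Let $A'_G$ be the quantifier-free symbolic heap $$\bigwedge_{i=1}^{n}(c_0+1\le c_i\wedge c_i\le b)\ :\ \mathop{*}_{(v_i,v_j)\in E}\big(c_i+e_{ij}\mapsto\mathsf{nil} * c_j+e_{ij}\mapsto\mathsf{nil}\big)$$ and $B'_G$ the quantifier-free symbolic heap $$(c_0+4\le b)\wedge\bigwedge_{i=1}^{n}(c_0+1\le c_i\wedge c_i\le b)\ :\ \mathop{*}_{(v_i,v_j)\in E}\big(c_i+e_{ij}\mapsto\mathsf{nil} * c_j+e_{ij}\mapsto\mathsf{nil}\big).$$ Then $A'_G\models B'_G$ is not valid if and only if $G$ has a proper $3$-colouring (colours from $\{1,2,3\}$, adjacent vertices receiving distinct colours).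
   Context: Minimal pointer arithmetic: terms $t ::= x \mid t+k$ ($x$ a variable, $k\in\mathbb{N}$); pure formulas $\Pi ::= t=t \mid t\le t \mid t<t \mid \Pi\wedge\Pi$; spatial formulas $F ::= \mathsf{emp}\mid t\mapsto\mathsf{nil}\mid F*F$; a quantifier-free symbolic heap is $\Pi:F$. Values are natural numbers or the non-addressable value $\mathit{nil}$. A stack $s$ maps variables to values, extended by $s(k)=k$, $s(t+k)=s(t)+k$, $s(\mathsf{nil})=\mathit{nil}$. A heap is a finite partial function from $\mathbb{N}$ to values; $h_1\circ h_2$ is the union of domain-disjoint heaps. $s,h\models t_1\sim t_2$ iff $s(t_1)\sim s(t_2)$; $\wedge$ as usual; $s,h\models\mathsf{emp}$ iff $h$ is empty; $s,h\models t\mapsto\mathsf{nil}$ iff $\mathrm{dom}(h)=\{s(t)\}$ and $h(s(t))=\mathit{nil}$; $s,h\models F_1*F_2$ iff $h=h_1\circ h_2$ with $s,h_1\models F_1$, $s,h_2\models F_2$; $s,h\models\Pi:F$ iff both parts hold. $A\models B$ (valid) means every $(s,h)$ satisfying $A$ satisfies $B$. -}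

module Defs where

open import Data.Nat using (ℕ; zero; suc; _+_; _*_; _≤_; _<_)
open import Data.Fin using (Fin; toℕ) renaming (zero to fzero; suc to fsuc)
open import Data.List.Base using (allFin)
open import Data.Maybe using (Maybe; just; nothing)
open import Data.List using (List; []; _∷_; foldr; map)
open import Data.List.Membership.Propositional using (_∈_)
open import Data.Product using (Σ; ∃; _×_; _,_)
open import Data.Sum using (_⊎_)
open import Data.Empty using (⊥)
open import Data.Unit using (⊤)
open import Relation.Binary.PropositionalEquality using (_≡_; _≢_)
open import Relation.Nullary using (¬_)

data Term (V : Set) : Set where
  var   : V → Term V
  _⊕_   : Term V → ℕ → Term V

infixl 6 _⊕_
infix 4 _=ₚ_ _≤ₚ_ _<ₚ_
infixr 3 _∧ₚ_
infix 5 _↦nil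
infixr 4 _✱_

data Pure (V : Set) : Set where
  ⊤ₚ    : Pure V
  _=ₚ_  : Term V → Term V → Pure V
  _≤ₚ_  : Term V → Term V → Pure V
  _<ₚ_  : Term V → Term V → Pure V
  _∧ₚ_  : Pure V → Pure V → Pure V

data Spatial (V : Set) : Set where
  emp   : Spatial V
  _↦nil : Term V → Spatial V
  _✱_   : Spatial V → Spatial V → Spatial V

record SH (V : Set) : Set where
  constructor _∶_
  field
    pure    : Pure V
    spatial : Spatial V

data Val : Set where
  num : ℕ → Val
  nil : Val

Stack : Set → Set
Stack V = V → Val

record Heap : Set where
  field
    fun    : ℕ → Maybe Val
    finite : ∃ λ N → ∀ a → N ≤ a → fun a ≡ nothing
open Heap public

addV : Val → ℕ → Val
addV (num m) k = num (m + k)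
addV nil     k = nil

⟦_⟧ : ∀ {V} → Term V → Stack V → Val
⟦ var x ⟧ s = s x
⟦ t ⊕ k ⟧ s = addV (⟦ t ⟧ s) k

_≤ᵥ_ : Val → Val → Set
num m ≤ᵥ num n = m ≤ n
_     ≤ᵥ _     = ⊥

_<ᵥ_ : Val → Val → Set
num m <ᵥ num n = m < n
_     <ᵥ _     = ⊥

SatPure : ∀ {V} → Stack V → Pure V → Set
SatPure s ⊤ₚ         = ⊤
SatPure s (t =ₚ u)   = ⟦ t ⟧ s ≡ ⟦ u ⟧ s
SatPure s (t ≤ₚ u)   = ⟦ t ⟧ s ≤ᵥ ⟦ u ⟧ s
SatPure s (t <ₚ u)   = ⟦ t ⟧ s <ᵥ ⟦ u ⟧ s
SatPure s (P ∧ₚ Q)   = SatPure s P × SatPure s Q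

merge : Maybe Val → Maybe Val → Maybe Val
merge (just v) _ = just v
merge nothing  m = m

IsUnion : Heap → Heap → Heap → Set
IsUnion h h₁ h₂ =
  (∀ a → fun h₁ a ≡ nothing ⊎ fun h₂ a ≡ nothing) ×
  (∀ a → fun h a ≡ merge (fun h₁ a) (fun h₂ a))

SatSp : ∀ {V} → Stack V → Heap → Spatial V → Set
SatSp s h emp       = ∀ a → fun h a ≡ nothing
SatSp s h (t ↦nil)  = Σ ℕ λ a → (⟦ t ⟧ s ≡ num a) × (fun h a ≡ just nil) ×
                        (∀ a' → a' ≢ a → fun h a' ≡ nothing)
SatSp s h (F ✱ G)   = Σ Heap λ h₁ → Σ Heap λ h₂ →
                        IsUnion h h₁ h₂ × SatSp s h₁ F × SatSp s h₂ G

Sat : ∀ {V} → Stack V → Heap → SH V → Set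
Sat s h (Π ∶ F) = SatPure s Π × SatSp s h F

_⊨_ : ∀ {V} → SH V → SH V → Set
_⊨_ {V} A B = (s : Stack V) (h : Heap) → Sat s h A → Sat s h B

-- Finite simple undirected graphs on vertices Fin n (vertex v_i of the
-- paper is the element i-1 of Fin n); each edge is listed once, in a
-- fixed orientation.

record Graph (n : ℕ) : Set where
  field
    edges   : List (Fin n × Fin n)
    noLoop  : ∀ {i j} → (i , j) ∈ edges → i ≢ j
    -- each unordered edge appears exactly once in the list
    unique  : ∀ {i j} → (p q : (i , j) ∈ edges ⊎ (j , i) ∈ edges) → p ≡ q
open Graph public

Adjacent : ∀ {n} → Graph n → Fin n → Fin n → Set
Adjacent G u v = (u , v) ∈ edges G ⊎ (v , u) ∈ edges G

Proper3Colouring : ∀ {n} → Graph n → (Fin n → Fin 3) → Set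
Proper3Colouring G f = ∀ u v → Adjacent G u v → f u ≢ f v

ThreeColourable : ∀ {n} → Graph n → Set
ThreeColourable {n} G = Σ (Fin n → Fin 3) λ f → Proper3Colouring G f

data GVar (n : ℕ) : Set where
  c : Fin (suc n) → GVar n
  b : GVar n

-- e_ij = i·n² + j·n  (with 1-based vertex indices)
e : ∀ {n} → Fin n → Fin n → ℕ
e {n} i j = suc (toℕ i) * n * n + suc (toℕ j) * n

c₀ : ∀ {n} → Term (GVar n)
c₀ = var (c fzero)

cv : ∀ {n} → Fin n → Term (GVar n)
cv i = var (c (fsuc i))

bounds : ∀ {n} → Pure (GVar n)
bounds {n} = foldr (λ i P → ((c₀ ⊕ 1 ≤ₚ cv i) ∧ₚ (cv i ≤ₚ var b)) ∧ₚ P) ⊤ₚ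
                   (allFin n)

edgeHeap : ∀ {n} → Graph n → Spatial (GVar n)
edgeHeap G = foldr (λ { (i , j) F → (((cv i ⊕ e i j) ↦nil) ✱ ((cv j ⊕ e i j) ↦nil)) ✱ F })
                   emp (edges G)

A′ : ∀ {n} → Graph n → SH (GVar n)
A′ G = bounds ∶ edgeHeap G

B′ : ∀ {n} → Graph n → SH (GVar n)
B′ G = ((c₀ ⊕ 4 ≤ₚ var b) ∧ₚ bounds) ∶ edgeHeap G

-- A model of A′_G puts every c_i in the window c₀ + 1, …, b, and the two cells of an edge
-- (v_i, v_j) force c_i ≠ c_j. When b < c₀ + 4 the window has at most three places, so the
-- offsets c_i − (c₀ + 1) form a proper 3-colouring; as 3-colourability is decidable, the
-- failure of A′_G ⊨ B′_G therefore yields a colouring. Conversely, a colouring by 1, 2, 3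
-- gives the countermodel c₀ = 0, b = 3, c_i = colour of v_i, with the heap allocating exactly
-- the cells c_i + e_ij: read in base n such an address determines the edge, so no two cells
-- collide.
module Submission where

open import Defs
open import Data.Nat using (ℕ; zero; suc; _+_; _*_; _∸_; _≤_; _<_; _≤?_; _≟_; s≤s; z≤n)
open import Data.Nat.Properties
  using ( suc-injective; +-comm; +-assoc; +-cancelˡ-≡; +-cancelʳ-≡; *-cancelʳ-≡; *-distribʳ-+
        ; <-≤-trans; ≤-<-trans; <⇒≱; ≰⇒>; m≤n⇒m≤1+n; m<n+o⇒m∸n<o; ∸-cancelʳ-≡ )
open import Data.Nat.DivMod using (_%_; [m+kn]%n≡m%n; m<n⇒m%n≡m)
open import Data.Fin using (Fin; toℕ; fromℕ<) renaming (zero to fzero; suc to fsuc)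
open import Data.Fin.Properties using (toℕ<n; toℕ-injective; fromℕ<-injective; any?; all?)
  renaming (_≟_ to _≟ᶠ_)
open import Data.List using (List; []; _∷_; _++_; foldr; allFin)
open import Data.List.Extrema.Nat using (max; xs≤max)
open import Data.List.Properties using (foldr-cong)
open import Data.List.Relation.Unary.Any using (here; there)
open import Data.List.Relation.Unary.Any.Properties using (there-injective)
open import Data.List.Relation.Unary.All as All using (All; []; _∷_)
import Data.List.Relation.Unary.All.Properties as Allₚ
open import Data.List.Relation.Unary.AllPairs using ([]; _∷_)
open import Data.List.Relation.Unary.Unique.Propositional using (Unique)
open import Data.List.Relation.Binary.Disjoint.Propositional using (Disjoint)
open import Data.List.Membership.Propositional using (_∈_; _∉_)
open import Data.List.Membership.Propositional.Properties using (∈-++⁺ˡ; ∈-++⁺ʳ; ∈-++⁻; ∈-allFin)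
open import Data.List.Membership.DecPropositional using () renaming (_∈?_ to member?)
open import Data.Maybe using (Maybe; just; nothing)
open import Data.Vec.Functional using (head; tail) renaming (_∷_ to _∷ᶠ_)
open import Data.Product using (∃; _×_; _,_; proj₁; proj₂)
open import Data.Product.Properties using (≡-dec)
open import Data.Sum using (_⊎_; inj₁; inj₂; [_,_]′)
open import Data.Sum.Properties using (inj₁-injective)
open import Data.Unit using (tt)
open import Function using (_∘_; id; flip; case_of_)
open import Relation.Nullary using (¬_; Dec; yes; no; contradiction)
open import Relation.Nullary.Decidable using (decidable-stable; _⊎-dec_; _→-dec_; ¬?)
open import Relation.Unary using (Decidable)
open import Relation.Binary.Definitions using (DecidableEquality)
open import Relation.Binary.PropositionalEquality

digit-injective : ∀ {n r r′ q q′} → r < n → r′ < n → r + q * n ≡ r′ + q′ * n → r ≡ r′ × q ≡ q′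
digit-injective {n@(suc _)} {r} {r′} {q} {q′} r<n r′<n eq = r≡r′ , q≡q′
  where
  r≡r′ : r ≡ r′
  r≡r′ = begin
    r                 ≡⟨ m<n⇒m%n≡m r<n ⟨
    r % n             ≡⟨ [m+kn]%n≡m%n r q n ⟨
    (r + q * n) % n   ≡⟨ cong (_% n) eq ⟩
    (r′ + q′ * n) % n ≡⟨ [m+kn]%n≡m%n r′ q′ n ⟩
    r′ % n            ≡⟨ m<n⇒m%n≡m r′<n ⟩
    r′                ∎
    where open ≡-Reasoning
  q≡q′ : q ≡ q′
  q≡q′ = *-cancelʳ-≡ q q′ n (+-cancelˡ-≡ r _ _ (trans eq (cong (_+ q′ * n) (sym r≡r′))))

e≡digits : ∀ {n} (i j : Fin n) → e i j ≡ suc (toℕ j + suc (toℕ i) * n) * n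
e≡digits {n} i j = trans (+-comm (suc (toℕ i) * n * n) _)
                         (sym (*-distribʳ-+ n (suc (toℕ j)) (suc (toℕ i) * n)))

-- suc r + e i j = n + 1 + (r + j·n + (i + 1)·n²), where r and j are base-n digits.
cell-injective : ∀ {n r r′} {i j i′ j′ : Fin n} → r < n → r′ < n →
                 suc r + e i j ≡ suc r′ + e i′ j′ → (i , j) ≡ (i′ , j′)
cell-injective {n} {r} {r′} {i} {j} {i′} {j′} r<n r′<n eq =
  cong₂ _,_ (toℕ-injective (suc-injective (proj₂ low))) (toℕ-injective (proj₁ low))
  where
  high : r ≡ r′ × suc (toℕ j + suc (toℕ i) * n) ≡ suc (toℕ j′ + suc (toℕ i′) * n)
  high = digit-injective r<n r′<n
    (suc-injective (trans (cong (suc r +_) (sym (e≡digits i j)))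
                          (trans eq (cong (suc r′ +_) (e≡digits i′ j′)))))
  low : toℕ j ≡ toℕ j′ × suc (toℕ i) ≡ suc (toℕ i′)
  low = digit-injective (toℕ<n j) (toℕ<n j′) (suc-injective (proj₂ high))

Unique-++⁻ : ∀ {A : Set} (xs : List A) {ys} → Unique (xs ++ ys) →
             Unique xs × Unique ys × Disjoint xs ys
Unique-++⁻ []       u        = [] , u , λ ()
Unique-++⁻ (x ∷ xs) (x∉ ∷ u) with Allₚ.++⁻ xs x∉ | Unique-++⁻ xs u
... | x∉xs , x∉ys | uxs , uys , disj =
  x∉xs ∷ uxs , uys , λ { (here refl , v∈ys) → All.lookup x∉ys v∈ys refl
                       ; (there v∈xs , v∈ys) → disj (v∈xs , v∈ys) }

∈-irrelevant⇒Unique : ∀ {A : Set} {xs : List A} → (∀ {x} (p q : x ∈ xs) → p ≡ q) → Unique xs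
∈-irrelevant⇒Unique {xs = []}     _   = []
∈-irrelevant⇒Unique {xs = x ∷ xs} irr =
  All.tabulate x∉xs ∷ ∈-irrelevant⇒Unique (λ p q → there-injective (irr (there p) (there q)))
  where
  x∉xs : ∀ {y} → y ∈ xs → x ≢ y
  x∉xs y∈xs refl = case irr (here refl) (there y∈xs) of λ ()

module _ (L : List ℕ) where
  private
    _∈L? : Decidable (_∈ L)
    a ∈L? = member? _≟_ a L

  allocated : ℕ → Maybe Val
  allocated a with a ∈L?
  ... | yes _ = just nil
  ... | no  _ = nothing

  allocated-∈ : ∀ {a} → a ∈ L → allocated a ≡ just nil
  allocated-∈ {a} a∈L with a ∈L?
  ... | yes _   = refl
  ... | no  a∉L = contradiction a∈L a∉L

  allocated-∉ : ∀ {a} → a ∉ L → allocated a ≡ nothing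
  allocated-∉ {a} a∉L with a ∈L?
  ... | yes a∈L = contradiction a∈L a∉L
  ... | no  _   = refl

  heapOn : Heap
  fun    heapOn = allocated
  finite heapOn = suc (max 0 L) , λ a max<a →
    allocated-∉ λ a∈L → <⇒≱ max<a (All.lookup (xs≤max 0 L) a∈L)

allocated-≡ : ∀ L L′ {a} → (a ∈ L → a ∈ L′) → (a ∈ L′ → a ∈ L) → allocated L a ≡ allocated L′ a
allocated-≡ L L′ {a} to from = case member? _≟_ a L of λ where
  (yes a∈L) → trans (allocated-∈ L a∈L) (sym (allocated-∈ L′ (to a∈L)))
  (no  a∉L) → trans (allocated-∉ L a∉L) (sym (allocated-∉ L′ (a∉L ∘ from)))

heapOn-++ : ∀ L₁ L₂ → Disjoint L₁ L₂ → IsUnion (heapOn (L₁ ++ L₂)) (heapOn L₁) (heapOn L₂)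
heapOn-++ L₁ L₂ disj = separate , combine
  where
  separate : ∀ a → allocated L₁ a ≡ nothing ⊎ allocated L₂ a ≡ nothing
  separate a = case member? _≟_ a L₁ of λ where
    (yes a∈L₁) → inj₂ (allocated-∉ L₂ λ a∈L₂ → disj (a∈L₁ , a∈L₂))
    (no  a∉L₁) → inj₁ (allocated-∉ L₁ a∉L₁)

  combine : ∀ a → allocated (L₁ ++ L₂) a ≡ merge (allocated L₁ a) (allocated L₂ a)
  combine a = case member? _≟_ a L₁ of λ where
    (yes a∈L₁) → trans (allocated-∈ (L₁ ++ L₂) (∈-++⁺ˡ a∈L₁))
                       (cong (λ m → merge m (allocated L₂ a)) (sym (allocated-∈ L₁ a∈L₁)))
    (no  a∉L₁) → trans (allocated-≡ (L₁ ++ L₂) L₂ ([ flip contradiction a∉L₁ , id ]′ ∘ ∈-++⁻ L₁) (∈-++⁺ʳ L₁))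
                       (cong (λ m → merge m (allocated L₂ a)) (sym (allocated-∉ L₁ a∉L₁)))

module _ {V : Set} (σ : V → ℕ) where

  ⟦_⟧ℕ : Term V → ℕ
  ⟦ var x ⟧ℕ = σ x
  ⟦ t ⊕ k ⟧ℕ = ⟦ t ⟧ℕ + k

  ⟦⟧-num : ∀ t → ⟦ t ⟧ (num ∘ σ) ≡ num ⟦ t ⟧ℕ
  ⟦⟧-num (var x) = refl
  ⟦⟧-num (t ⊕ k) = cong (λ v → addV v k) (⟦⟧-num t)

  cells : Spatial V → List ℕ
  cells emp      = []
  cells (t ↦nil) = ⟦ t ⟧ℕ ∷ []
  cells (F ✱ G)  = cells F ++ cells G

  heapOn-cells-sat : ∀ F → Unique (cells F) → SatSp (num ∘ σ) (heapOn (cells F)) F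
  heapOn-cells-sat emp      _ a = allocated-∉ [] {a} λ ()
  heapOn-cells-sat (t ↦nil) _   =
    ⟦ t ⟧ℕ , ⟦⟧-num t , allocated-∈ _ (here refl) , λ a a≢ → allocated-∉ _ λ { (here a≡) → a≢ a≡ }
  heapOn-cells-sat (F ✱ G)  u with Unique-++⁻ (cells F) u
  ... | uF , uG , disj = heapOn (cells F) , heapOn (cells G) , heapOn-++ (cells F) (cells G) disj ,
                         heapOn-cells-sat F uF , heapOn-cells-sat G uG

⋀ : ∀ {V A : Set} → (A → Pure V) → List A → Pure V
⋀ φ = foldr (λ x P → φ x ∧ₚ P) ⊤ₚ

module _ {V A : Set} {s : Stack V} (φ : A → Pure V) where

  ⋀⇒All : ∀ xs → SatPure s (⋀ φ xs) → All (SatPure s ∘ φ) xs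
  ⋀⇒All []       _        = []
  ⋀⇒All (x ∷ xs) (p , ps) = p ∷ ⋀⇒All xs ps

  All⇒⋀ : ∀ {xs} → All (SatPure s ∘ φ) xs → SatPure s (⋀ φ xs)
  All⇒⋀ []       = tt
  All⇒⋀ (p ∷ ps) = p , All⇒⋀ ps

_≤ᵥ?_ : ∀ u v → Dec (u ≤ᵥ v)
num m ≤ᵥ? num n = m ≤? n
num _ ≤ᵥ? nil   = no id
nil   ≤ᵥ? _     = no id

↦nil-✱-distinct : ∀ {V} {s : Stack V} {h} t u → SatSp s h ((t ↦nil) ✱ (u ↦nil)) → ⟦ t ⟧ s ≢ ⟦ u ⟧ s
↦nil-✱-distinct t u (_ , _ , (disjoint , _) , (a , t≡a , h₁a , _) , (_ , u≡a′ , h₂a′ , _)) t≡u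
  with trans (sym t≡a) (trans t≡u u≡a′)
... | refl = case disjoint a of λ where
  (inj₁ h₁a≡nothing) → case trans (sym h₁a) h₁a≡nothing of λ ()
  (inj₂ h₂a≡nothing) → case trans (sym h₂a′) h₂a≡nothing of λ ()

vertexBounds : ∀ {n} → Fin n → Pure (GVar n)
vertexBounds i = (c₀ ⊕ 1 ≤ₚ cv i) ∧ₚ (cv i ≤ₚ var b)

edgeCells : ∀ {n} → Fin n × Fin n → Spatial (GVar n)
edgeCells (i , j) = ((cv i ⊕ e i j) ↦nil) ✱ ((cv j ⊕ e i j) ↦nil)

edgesHeap : ∀ {n} → List (Fin n × Fin n) → Spatial (GVar n)
edgesHeap = foldr (λ ij F → edgeCells ij ✱ F) emp

edgeHeap≡edgesHeap : ∀ {n} (G : Graph n) → edgeHeap G ≡ edgesHeap (edges G)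
edgeHeap≡edgesHeap G = foldr-cong (λ _ _ → refl) refl (edges G)

bounds⇒vertexBounds : ∀ {n} {s : Stack (GVar n)} → SatPure s bounds → ∀ i → SatPure s (vertexBounds i)
bounds⇒vertexBounds {n} ⊨bounds i = All.lookup (⋀⇒All vertexBounds (allFin n) ⊨bounds) (∈-allFin i)

edges-Unique : ∀ {n} (G : Graph n) → Unique (edges G)
edges-Unique G = ∈-irrelevant⇒Unique λ p q → inj₁-injective (unique G (inj₁ p) (inj₁ q))

-- A 3-colouring gives a countermodel

-- Colours below n keep each cell address a base-n numeral whose digits name the edge.
record DigitColouring {n} (G : Graph n) : Set where
  field
    colour   : Fin n → ℕ
    colour<n : ∀ i → colour i < n
    colour<3 : ∀ i → colour i < 3
    proper   : ∀ {i j} → (i , j) ∈ edges G → colour i ≢ colour j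

threeColourable⇒DigitColouring : ∀ {n} {G : Graph n} → ThreeColourable G → DigitColouring G
threeColourable⇒DigitColouring {n} {G} (f , f-proper) with n ≤? 2
... | yes n≤2 = record   -- with at most two vertices, colouring by index keeps colours below n
  { colour   = toℕ
  ; colour<n = toℕ<n
  ; colour<3 = λ i → <-≤-trans (toℕ<n i) (m≤n⇒m≤1+n n≤2)
  ; proper   = λ ij → noLoop G ij ∘ toℕ-injective
  }
... | no n≰2 = record
  { colour   = toℕ ∘ f
  ; colour<n = λ i → <-≤-trans (toℕ<n (f i)) (≰⇒> n≰2)
  ; colour<3 = toℕ<n ∘ f
  ; proper   = λ {i} {j} ij → f-proper i j (inj₁ ij) ∘ toℕ-injective
  }

module Countermodel {n} {G : Graph n} (κ : DigitColouring G) where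
  open DigitColouring κ

  σ : GVar n → ℕ
  σ (c fzero)    = 0
  σ (c (fsuc i)) = suc (colour i)
  σ b            = 3

  cells-fresh : ∀ {i j} v {es} → All ((i , j) ≢_) es →
                All (suc (colour v) + e i j ≢_) (cells σ (edgesHeap es))
  cells-fresh v []                          = []
  cells-fresh v {(i′ , j′) ∷ _} (ij≢ ∷ ij∉) =
    ij≢ ∘ cell-injective (colour<n v) (colour<n i′) ∷
    ij≢ ∘ cell-injective (colour<n v) (colour<n j′) ∷ cells-fresh v ij∉

  cells-Unique : ∀ {es} → Unique es → (∀ {i j} → (i , j) ∈ es → colour i ≢ colour j) →
                 Unique (cells σ (edgesHeap es))
  cells-Unique               []        _       = []
  cells-Unique {(i , j) ∷ _} (ij∉ ∷ u) proper′ =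
    (proper′ (here refl) ∘ suc-injective ∘ +-cancelʳ-≡ (e i j) _ _ ∷ cells-fresh i ij∉) ∷
    cells-fresh j ij∉ ∷ cells-Unique u (proper′ ∘ there)

  heap : Heap
  heap = heapOn (cells σ (edgesHeap (edges G)))

  ⊨A′ : Sat (num ∘ σ) heap (A′ G)
  ⊨A′ = All⇒⋀ {s = num ∘ σ} vertexBounds {allFin n} (All.tabulate λ {i} _ → s≤s z≤n , colour<3 i) ,
        subst (SatSp (num ∘ σ) heap) (sym (edgeHeap≡edgesHeap G))
              (heapOn-cells-sat σ _ (cells-Unique (edges-Unique G) proper))

  ⊭B′ : ¬ Sat (num ∘ σ) heap (B′ G)
  ⊭B′ ((s≤s (s≤s (s≤s ())) , _) , _)

threeColourable⇒invalid : ∀ {n} (G : Graph n) → ThreeColourable G → ¬ (A′ G ⊨ B′ G)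
threeColourable⇒invalid G col valid = ⊭B′ (valid (num ∘ σ) heap ⊨A′)
  where open Countermodel (threeColourable⇒DigitColouring {G = G} col)

-- A model of A′ refuting B′ gives a 3-colouring

window : ∀ {m x k} → m + 1 ≤ x → x ≤ k → k < m + 4 → x ∸ (m + 1) < 3
window {m} {x} _ x≤k k<m+4 =
  m<n+o⇒m∸n<o x (m + 1) (subst (x <_) (sym (+-assoc m 1 3)) (≤-<-trans x≤k k<m+4))

slot : ∀ u v w → addV u 1 ≤ᵥ v → v ≤ᵥ w → ¬ (addV u 4 ≤ᵥ w) → Fin 3
slot (num m) (num x) (num k) lo hi narrow = fromℕ< (window lo hi (≰⇒> narrow))

slot-injective : ∀ {u v v′ w} lo hi lo′ hi′ narrow →
                 slot u v w lo hi narrow ≡ slot u v′ w lo′ hi′ narrow → v ≡ v′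
slot-injective {num m} {num x} {num y} {num k} lo hi lo′ hi′ narrow eq =
  cong num (∸-cancelʳ-≡ lo lo′ (fromℕ<-injective _ _ _ _ eq))

edgesHeap-distinct : ∀ {n} {s : Stack (GVar n)} {h} es → SatSp s h (edgesHeap es) →
                     ∀ {i j} → (i , j) ∈ es → s (c (fsuc i)) ≢ s (c (fsuc j))
edgesHeap-distinct {s = s} ((i , j) ∷ _) (h₁ , _ , _ , ⊨cells , _) (here refl) ci≡cj =
  ↦nil-✱-distinct {s = s} {h₁} (cv i ⊕ e i j) (cv j ⊕ e i j) ⊨cells (cong (λ v → addV v (e i j)) ci≡cj)
edgesHeap-distinct (_ ∷ es) (_ , _ , _ , _ , ⊨rest) (there ij∈) = edgesHeap-distinct es ⊨rest ij∈

A′⇒B′-or-threeColourable : ∀ {n} (G : Graph n) {s h} → Sat s h (A′ G) →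
                           SatPure s (c₀ ⊕ 4 ≤ₚ var b) ⊎ ThreeColourable G
A′⇒B′-or-threeColourable G {s} {h} (⊨bounds , ⊨edges) with addV (s (c fzero)) 4 ≤ᵥ? s b
... | yes wide   = inj₁ wide
... | no  narrow = inj₂ (colour , proper)
  where
  lo : ∀ i → addV (s (c fzero)) 1 ≤ᵥ s (c (fsuc i))
  lo = proj₁ ∘ bounds⇒vertexBounds ⊨bounds
  hi : ∀ i → s (c (fsuc i)) ≤ᵥ s b
  hi = proj₂ ∘ bounds⇒vertexBounds ⊨bounds

  colour : Fin _ → Fin 3
  colour i = slot _ _ _ (lo i) (hi i) narrow

  distinct : ∀ {i j} → (i , j) ∈ edges G → s (c (fsuc i)) ≢ s (c (fsuc j))
  distinct = edgesHeap-distinct (edges G) (subst (SatSp s h) (edgeHeap≡edgesHeap G) ⊨edges)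

  proper : Proper3Colouring G colour
  proper u v (inj₁ uv) = distinct uv ∘ slot-injective (lo u) (hi u) (lo v) (hi v) narrow
  proper u v (inj₂ vu) = distinct vu ∘ slot-injective (lo v) (hi v) (lo u) (hi u) narrow ∘ sym

¬threeColourable⇒valid : ∀ {n} (G : Graph n) → ¬ ThreeColourable G → A′ G ⊨ B′ G
¬threeColourable⇒valid G ¬col s h ⊨A′@(⊨bounds , ⊨edges) =
  [ (λ wide → (wide , ⊨bounds) , ⊨edges) , flip contradiction ¬col ]′ (A′⇒B′-or-threeColourable G ⊨A′)

∷-cong : ∀ {m} {A : Set} (x : A) {f g : Fin m → A} → f ≗ g → (x ∷ᶠ f) ≗ (x ∷ᶠ g)
∷-cong x f≗g fzero    = refl
∷-cong x f≗g (fsuc i) = f≗g i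

head∷tail : ∀ {m} {A : Set} (f : Fin (suc m) → A) → f ≗ (head f ∷ᶠ tail f)
head∷tail f fzero    = refl
head∷tail f (fsuc i) = refl

any?-function : ∀ m {k} {P : (Fin m → Fin k) → Set} →
                (∀ {f g} → f ≗ g → P f → P g) → Decidable P → Dec (∃ P)
any?-function zero resp P? with P? (λ ())
... | yes p  = yes (_ , p)
... | no  ¬p = no λ (f , pf) → ¬p (resp (λ ()) pf)
any?-function (suc m) resp P?
  with any? (λ x → any?-function m (resp ∘ ∷-cong x) (P? ∘ (x ∷ᶠ_)))
... | yes (x , f , pf) = yes (x ∷ᶠ f , pf)
... | no  ¬p           = no λ (f , pf) → ¬p (head f , tail f , resp (head∷tail f) pf)

module _ {n} (G : Graph n) where

  adjacent? : ∀ u v → Dec (Adjacent G u v)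
  adjacent? u v = member? pair≟ (u , v) (edges G) ⊎-dec member? pair≟ (v , u) (edges G)
    where
    pair≟ : DecidableEquality (Fin n × Fin n)
    pair≟ = ≡-dec _≟ᶠ_ _≟ᶠ_

  proper? : Decidable (Proper3Colouring G)
  proper? f = all? λ u → all? λ v → adjacent? u v →-dec ¬? (f u ≟ᶠ f v)

  threeColourable? : Dec (ThreeColourable G)
  threeColourable? = any?-function n (λ f≗g pf u v adj → pf u v adj ∘ respect f≗g) proper?
    where
    respect : ∀ {f g : Fin n → Fin 3} {u v} → f ≗ g → g u ≡ g v → f u ≡ f v
    respect {u = u} {v} f≗g eq = trans (f≗g u) (trans eq (sym (f≗g v)))

lemma5 : ∀ (n : ℕ) (G : Graph n) →
    ((¬ (A′ G ⊨ B′ G)) → ThreeColourable G) × (ThreeColourable G → ¬ (A′ G ⊨ B′ G))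
lemma5 n G = invalid⇒threeColourable , threeColourable⇒invalid G
  where
  invalid⇒threeColourable : ¬ (A′ G ⊨ B′ G) → ThreeColourable G
  invalid⇒threeColourable invalid =
    decidable-stable (threeColourable? G) (invalid ∘ ¬threeColourable⇒valid G)
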